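{- Let $p$ be a prime, let $\mathcal{C}$ be a linear $[n,k,d]_p$ code and let $s$ be a positive integer. If $d_L(\mathcal{C})>\lfloor\mu_p(n-k-s)\rfloor$, then $d\ge n-k-s+1$; equivalently, the Singleton defect satisfies $\operatorname{def}(\mathcal{C})\le s$.
   Context: A linear $[n,k,d]_p$ code is a $k$-dimensional subspace of $\mathbb{Z}_p^n$ with minimum Hamming distance $d$; its Singleton defect is $\operatorname{def}(\mathcal{C})=n-k+1-d$. The Lee weight of $a\in\mathbb{Z}_p$ (as an integer in $\{0,\dots,p-1\}$) is $\min\{a,p-a\}$, the Lee weight of a vector is the sum over coordinates, and $d_L(\mathcal{C})$ is the minimum Lee weight of a nonzero codeword. $\mu_p$ is the average Lee weight of the nonzero elements of $\mathbb{Z}_p$: $\mu_2=1$ and $\mu_p=\frac{p+1}{4}$ for odd $p$. -}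

module Defs where

open import Data.Nat using (ℕ; zero; suc; _+_; _*_; _∸_; _≡ᵇ_; NonZero; _⊓_)
open import Data.Nat.DivMod using (_mod_; _/_)
open import Data.Fin using (Fin; toℕ) renaming (zero to fzero)
open import Data.Empty using (⊥)
open import Data.Bool using (if_then_else_)
open import Data.Product using (Σ; ∃; _×_)
open import Relation.Binary.PropositionalEquality using (_≡_; _≢_)

-- Elements of Z_p are represented by Fin p (integers 0..p-1).
Vec𝔽 : (p n : ℕ) → Set
Vec𝔽 p n = Fin n → Fin p

∑ : (k : ℕ) → (Fin k → ℕ) → ℕ
∑ zero    f = 0
∑ (suc k) f = f fzero + ∑ k (λ i → f (Data.Fin.suc i))

comb : {p n k : ℕ} .{{_ : NonZero p}} → (Fin k → Vec𝔽 p n) → (Fin k → Fin p) → Vec𝔽 p n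
comb {p} {n} {k} G c j = (∑ k (λ i → toℕ (c i) * toℕ (G i j))) mod p

IsZero : {p m : ℕ} → (Fin m → Fin p) → Set
IsZero x = ∀ j → toℕ (x j) ≡ 0

LinIndep : {p n k : ℕ} .{{_ : NonZero p}} → (Fin k → Vec𝔽 p n) → Set
LinIndep G = ∀ c → IsZero (comb G c) → IsZero c

record LinearCode (p n k : ℕ) .{{_ : NonZero p}} : Set where
  field
    basis   : Fin k → Vec𝔽 p n
    indep   : LinIndep basis

_∈C_ : {p n k : ℕ} .{{_ : NonZero p}} → Vec𝔽 p n → LinearCode p n k → Set
_∈C_ {p} {n} {k} x C = Σ (Fin k → Fin p) λ c → ∀ j → comb (LinearCode.basis C) c j ≡ x j

hammingWt : {p n : ℕ} → Vec𝔽 p n → ℕ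
hammingWt {p} {n} x = ∑ n (λ j → if toℕ (x j) ≡ᵇ 0 then 0 else 1)

leeWtℤp : (p : ℕ) → Fin p → ℕ
leeWtℤp p a = toℕ a ⊓ (p ∸ toℕ a)

leeWt : {p n : ℕ} → Vec𝔽 p n → ℕ
leeWt {p} {n} x = ∑ n (λ j → leeWtℤp p (x j))

IsMinWt : {p n k : ℕ} .{{_ : NonZero p}} → (Vec𝔽 p n → ℕ) → LinearCode p n k → ℕ → Set
IsMinWt {p} {n} wt C w =
  (Σ (Vec𝔽 p n) λ x → x ∈C C × ¬Z x × wt x ≡ w) ×
  (∀ (x : Vec𝔽 p n) → x ∈C C → ¬Z x → w Data.Nat.≤ wt x)
  where ¬Z : Vec𝔽 p n → Set
        ¬Z x = IsZero x → ⊥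

IsMinDist : {p n k : ℕ} .{{_ : NonZero p}} → LinearCode p n k → ℕ → Set
IsMinDist = IsMinWt hammingWt

IsMinLeeDist : {p n k : ℕ} .{{_ : NonZero p}} → LinearCode p n k → ℕ → Set
IsMinLeeDist = IsMinWt leeWt

-- ⌊ μ_p · m ⌋ for m ∈ ℕ, where μ_2 = 1 and μ_p = (p+1)/4 for odd p
floorMu : (p m : ℕ) → ℕ
floorMu p m = if p ≡ᵇ 2 then m else ((p + 1) * m) / 4

-- Let x be a codeword of Hamming weight d. Its p - 1 nonzero multiples λx are nonzero
-- codewords, so each has Lee weight at least d_L. For a nonzero coordinate a, λ ↦ λa permutes
-- ℤ_p, so summing over all λ the Lee weights of the λx gives d times the total Lee weight of
-- ℤ_p, which is (p - 1) μ_p. Hence (p - 1) d_L ≤ (p - 1) μ_p d, i.e. d_L ≤ ⌊μ_p d⌋, and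
-- d ≤ n - k - s would contradict ⌊μ_p (n - k - s)⌋ < d_L.
module Submission where

open import Defs
open import Data.Nat
  using (ℕ; NonZero; zero; suc; _+_; _*_; _∸_; _%_; _/_; _⊓_; _≡ᵇ_; _<_; _≤_; z≤n; s≤s; ≢-nonZero; nonTrivial⇒n>1)
open import Data.Nat.Primality
  using (Prime; euclidsLemma; prime⇒nonTrivial; prime⇒irreducible; ¬prime[0]; ¬prime[1])
open import Data.Nat.Properties
open import Data.Nat.DivMod
open import Data.Nat.Divisibility using (_∣_; m%n≡0⇒n∣m; >⇒∤)
open import Data.Nat.Coprimality using (Coprime; coprime-Bézout; prime⇒coprime)
open import Data.Nat.GCD using (module Bézout)
open import Data.Nat.Tactic.RingSolver using (solve-∀; solve)
open import Data.List using (_∷_; [])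
open import Function using (_∘_)
open import Data.Fin using (Fin; toℕ) renaming (zero to fzero; suc to fsuc)
open import Data.Fin.Properties using (toℕ-injective; toℕ-fromℕ<; toℕ<n)
open import Data.Fin.Permutation using (Permutation; permutation)
open import Algebra.Properties.Semiring.Sum +-*-semiring
  using (sum; sum-cong-≗; sum-replicate-zero; ∑-comm; ∑-distrib-+; sum-permute; *-distribˡ-sum; *-distribʳ-sum)
open import Data.Bool using (true; false; T; if_then_else_)
open import Data.Product using (∃-syntax; _,_; proj₁; proj₂)
open import Data.Sum using ([_,_])
open import Relation.Binary.PropositionalEquality hiding ([_])
open import Relation.Nullary using (¬_; contradiction; yes; no)
open import Relation.Nullary.Decidable using (decidable-stable; dec-false)

∑≡sum : ∀ k (f : Fin k → ℕ) → ∑ k f ≡ sum f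
∑≡sum zero    f = refl
∑≡sum (suc k) f = cong (f fzero +_) (∑≡sum k (λ i → f (fsuc i)))

sum-const : ∀ n c → sum {n} (λ _ → c) ≡ n * c
sum-const zero    c = refl
sum-const (suc n) c = cong (c +_) (sum-const n c)

sum-mono-≤ : ∀ {n} {f g : Fin n → ℕ} → (∀ i → f i ≤ g i) → sum f ≤ sum g
sum-mono-≤ {zero}  f≤g = z≤n
sum-mono-≤ {suc n} f≤g = +-mono-≤ (f≤g fzero) (sum-mono-≤ (λ i → f≤g (fsuc i)))

sum-toℕ-+ : ∀ m n (g : ℕ → ℕ) →
            sum {m + n} (λ i → g (toℕ i)) ≡ sum {m} (λ i → g (toℕ i)) + sum {n} (λ i → g (m + toℕ i))
sum-toℕ-+ zero    n g = refl
sum-toℕ-+ (suc m) n g = trans (cong (g 0 +_) (sum-toℕ-+ m n (λ i → g (suc i))))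
                              (sym (+-assoc (g 0) _ _))

module _ {d : ℕ} .{{_ : NonZero d}} where
  open ≡-Reasoning

  sum-cong-% : ∀ {n} {f g : Fin n → ℕ} → (∀ i → f i % d ≡ g i % d) → sum f % d ≡ sum g % d
  sum-cong-% {zero}  f≡g = refl
  sum-cong-% {suc n} {f} {g} f≡g = begin
    (f fzero + sum (λ i → f (fsuc i))) % d
      ≡⟨ %-distribˡ-+ (f fzero) _ d ⟩
    (f fzero % d + sum (λ i → f (fsuc i)) % d) % d
      ≡⟨ cong₂ (λ a b → (a + b) % d) (f≡g fzero) (sum-cong-% (λ i → f≡g (fsuc i))) ⟩
    (g fzero % d + sum (λ i → g (fsuc i)) % d) % d
      ≡⟨ %-distribˡ-+ (g fzero) _ d ⟨
    (g fzero + sum (λ i → g (fsuc i))) % d ∎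

  [m%d*n]%d≡[m*n]%d : ∀ m n → (m % d * n) % d ≡ (m * n) % d
  [m%d*n]%d≡[m*n]%d m n = begin
    (m % d * n) % d             ≡⟨ %-distribˡ-* (m % d) n d ⟩
    (m % d % d * (n % d)) % d   ≡⟨ cong (λ t → (t * (n % d)) % d) (m%n%n≡m%n m d) ⟩
    (m % d * (n % d)) % d       ≡⟨ %-distribˡ-* m n d ⟨
    (m * n) % d ∎

  [m*[n%d]]%d≡[m*n]%d : ∀ m n → (m * (n % d)) % d ≡ (m * n) % d
  [m*[n%d]]%d≡[m*n]%d m n = begin
    (m * (n % d)) % d  ≡⟨ cong (_% d) (*-comm m (n % d)) ⟩
    (n % d * m) % d    ≡⟨ [m%d*n]%d≡[m*n]%d n m ⟩
    (n * m) % d        ≡⟨ cong (_% d) (*-comm n m) ⟩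
    (m * n) % d ∎

  m*d≤n⇒m≤n/d : ∀ {m n} → m * d ≤ n → m ≤ n / d
  m*d≤n⇒m≤n/d {m} {n} m*d≤n = subst (_≤ n / d) (m*n/n≡m m d) (/-monoˡ-≤ d m*d≤n)

  coprime⇒%-inverse : ∀ {m} → Coprime d m → ∃[ k ] (m * k) % d ≡ 1 % d
  coprime⇒%-inverse {m} d⊥m with coprime-Bézout d⊥m
  ... | Bézout.-+ x y 1+xd≡ym = y , (begin
    (m * y) % d        ≡⟨ cong (_% d) (*-comm m y) ⟩
    (y * m) % d        ≡⟨ cong (_% d) 1+xd≡ym ⟨
    (1 + x * d) % d    ≡⟨ [m+kn]%n≡m%n 1 x d ⟩
    1 % d ∎)
  -- here y * m ≡ -1 (mod d), so (d - 1) * y inverts m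
  ... | Bézout.+- x y 1+ym≡xd = q * y , (begin
    (m * (q * y)) % d               ≡⟨ [m+n]%n≡m%n (m * (q * y)) d ⟨
    (m * (q * y) + d) % d           ≡⟨ cong (λ t → (m * (q * y) + t) % d) (suc-pred d) ⟨
    (m * (q * y) + suc q) % d       ≡⟨ cong (_% d) (regroup m q y) ⟩
    (1 + q * (1 + y * m)) % d       ≡⟨ cong (λ t → (1 + q * t) % d) 1+ym≡xd ⟩
    (1 + q * (x * d)) % d           ≡⟨ cong (λ t → (1 + t) % d) (*-assoc q x d) ⟨
    (1 + q * x * d) % d             ≡⟨ [m+kn]%n≡m%n 1 (q * x) d ⟩
    1 % d ∎)
    where
    q : ℕ
    q = d ∸ 1
    regroup : ∀ m q y → m * (q * y) + suc q ≡ 1 + q * (1 + y * m)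
    regroup = solve-∀

module ℤₚ {p : ℕ} .{{_ : NonZero p}} where
  open ≡-Reasoning

  infixl 7 _·_

  _·_ : Fin p → Fin p → Fin p
  a · b = (toℕ a * toℕ b) mod p

  toℕ-· : ∀ a b → toℕ (a · b) ≡ (toℕ a * toℕ b) % p
  toℕ-· a b = toℕ-fromℕ< (m%n<n (toℕ a * toℕ b) p)

  ·-comm : ∀ a b → a · b ≡ b · a
  ·-comm a b = cong (_mod p) (*-comm (toℕ a) (toℕ b))

  ·-assoc : ∀ a b c → (a · b) · c ≡ a · (b · c)
  ·-assoc a b c = toℕ-injective (begin
    toℕ ((a · b) · c)            ≡⟨ toℕ-· (a · b) c ⟩
    (toℕ (a · b) * C) % p        ≡⟨ cong (λ t → (t * C) % p) (toℕ-· a b) ⟩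
    ((A * B) % p * C) % p        ≡⟨ [m%d*n]%d≡[m*n]%d (A * B) C ⟩
    (A * B * C) % p              ≡⟨ cong (_% p) (*-assoc A B C) ⟩
    (A * (B * C)) % p            ≡⟨ [m*[n%d]]%d≡[m*n]%d A (B * C) ⟨
    (A * ((B * C) % p)) % p      ≡⟨ cong (λ t → (A * t) % p) (toℕ-· b c) ⟨
    (A * toℕ (b · c)) % p        ≡⟨ toℕ-· a (b · c) ⟨
    toℕ (a · (b · c)) ∎)
    where
    A B C : ℕ
    A = toℕ a
    B = toℕ b
    C = toℕ c

  ·-identityʳ : ∀ a {e} → toℕ e ≡ 1 → a · e ≡ a
  ·-identityʳ a {e} e≡1 = toℕ-injective (begin
    toℕ (a · e)         ≡⟨ toℕ-· a e ⟩
    (toℕ a * toℕ e) % p ≡⟨ cong (λ t → (toℕ a * t) % p) e≡1 ⟩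
    (toℕ a * 1) % p     ≡⟨ cong (_% p) (*-identityʳ (toℕ a)) ⟩
    toℕ a % p           ≡⟨ m<n⇒m%n≡m (toℕ<n a) ⟩
    toℕ a ∎)

  ·-zeroʳ : ∀ a {z} → toℕ z ≡ 0 → toℕ (a · z) ≡ 0
  ·-zeroʳ a {z} z≡0 = begin
    toℕ (a · z)          ≡⟨ toℕ-· a z ⟩
    (toℕ a * toℕ z) % p  ≡⟨ cong (λ t → (toℕ a * t) % p) z≡0 ⟩
    (toℕ a * 0) % p      ≡⟨ cong (_% p) (*-zeroʳ (toℕ a)) ⟩
    0 % p                ≡⟨ m*n%n≡0 0 p ⟩
    0 ∎

  ·-cancelʳ : ∀ {u v} → toℕ (u · v) ≡ 1 → ∀ a → (a · u) · v ≡ a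
  ·-cancelʳ {u} {v} uv≡1 a = trans (·-assoc a u v) (·-identityʳ a uv≡1)

  module _ (p-prime : Prime p) where

    ·-nonzero : ∀ {a b} → toℕ a ≢ 0 → toℕ b ≢ 0 → toℕ (a · b) ≢ 0
    ·-nonzero {a} {b} a≢0 b≢0 ab≡0 =
      [ p∤ a≢0 , p∤ b≢0 ] (euclidsLemma (toℕ a) (toℕ b) p-prime (m%n≡0⇒n∣m _ p (trans (sym (toℕ-· a b)) ab≡0)))
      where
      p∤ : ∀ {c : Fin p} → toℕ c ≢ 0 → ¬ (p ∣ toℕ c)
      p∤ {c} c≢0 = >⇒∤ {{≢-nonZero c≢0}} (toℕ<n c)

    ·-inverse : ∀ a → toℕ a ≢ 0 → ∃[ b ] toℕ (a · b) ≡ 1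
    ·-inverse a a≢0 =
      let k , ak≡1 = coprime⇒%-inverse (prime⇒coprime p-prime {{≢-nonZero a≢0}} (toℕ<n a)) in
      k mod p , (begin
        toℕ (a · (k mod p))          ≡⟨ toℕ-· a (k mod p) ⟩
        (toℕ a * toℕ (k mod p)) % p  ≡⟨ cong (λ t → (toℕ a * t) % p) (toℕ-fromℕ< (m%n<n k p)) ⟩
        (toℕ a * (k % p)) % p        ≡⟨ [m*[n%d]]%d≡[m*n]%d (toℕ a) k ⟩
        (toℕ a * k) % p              ≡⟨ ak≡1 ⟩
        1 % p                        ≡⟨ m<n⇒m%n≡m (nonTrivial⇒n>1 p {{prime⇒nonTrivial p-prime}}) ⟩
        1 ∎)

    ·ʳ-permutation : ∀ a → toℕ a ≢ 0 → Permutation p p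
    ·ʳ-permutation a a≢0 = permutation (_· a) (_· b) (·-cancelʳ ba≡1) (·-cancelʳ ab≡1)
      where
      b : Fin p
      b = proj₁ (·-inverse a a≢0)
      ab≡1 : toℕ (a · b) ≡ 1
      ab≡1 = proj₂ (·-inverse a a≢0)
      ba≡1 : toℕ (b · a) ≡ 1
      ba≡1 = trans (cong toℕ (·-comm b a)) ab≡1

open ℤₚ

totalLeeWt : ℕ → ℕ
totalLeeWt p = sum (leeWtℤp p)

module _ {p : ℕ} .{{_ : NonZero p}} where
  open ≡-Reasoning

  scale : ∀ {n} → Fin p → Vec𝔽 p n → Vec𝔽 p n
  scale l x j = l · x j

  toℕ-comb : ∀ {n k} (G : Fin k → Vec𝔽 p n) c j →
             toℕ (comb G c j) ≡ sum (λ i → toℕ (c i) * toℕ (G i j)) % p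
  toℕ-comb {k = k} G c j = trans (toℕ-fromℕ< _) (cong (_% p) (∑≡sum k _))

  comb-scale : ∀ {n k} (G : Fin k → Vec𝔽 p n) l c j → comb G (λ i → l · c i) j ≡ l · comb G c j
  comb-scale {k = k} G l c j = toℕ-injective (begin
    toℕ (comb G (λ i → l · c i) j)          ≡⟨ toℕ-comb G (λ i → l · c i) j ⟩
    sum (λ i → toℕ (l · c i) * g i) % p     ≡⟨ sum-cong-% {p} (λ i → pull-out (c i) (g i)) ⟩
    sum (λ i → L * (toℕ (c i) * g i)) % p   ≡⟨ cong (_% p) (*-distribˡ-sum L cg) ⟨
    (L * sum cg) % p                        ≡⟨ [m*[n%d]]%d≡[m*n]%d L (sum cg) ⟨
    (L * (sum cg % p)) % p                  ≡⟨ cong (λ t → (L * t) % p) (toℕ-comb G c j) ⟨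
    (L * toℕ (comb G c j)) % p              ≡⟨ toℕ-· l (comb G c j) ⟨
    toℕ (l · comb G c j) ∎)
    where
    L : ℕ
    L = toℕ l
    g cg : Fin k → ℕ
    g i = toℕ (G i j)
    cg i = toℕ (c i) * g i
    pull-out : ∀ c g → (toℕ (l · c) * g) % p ≡ (L * (toℕ c * g)) % p
    pull-out c g = begin
      (toℕ (l · c) * g) % p      ≡⟨ cong (λ t → (t * g) % p) (toℕ-· l c) ⟩
      ((L * toℕ c) % p * g) % p  ≡⟨ [m%d*n]%d≡[m*n]%d (L * toℕ c) g ⟩
      (L * toℕ c * g) % p        ≡⟨ cong (_% p) (*-assoc L (toℕ c) g) ⟩
      (L * (toℕ c * g)) % p ∎

  ∈C-scale : ∀ {n k} (C : LinearCode p n k) l {x} → x ∈C C → scale l x ∈C C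
  ∈C-scale C l (c , c≡x) =
    (λ i → l · c i) , λ j → trans (comb-scale (LinearCode.basis C) l c j) (cong (l ·_) (c≡x j))

  module _ (p-prime : Prime p) where

    scale-nonzero : ∀ {n l} {x : Vec𝔽 p n} → toℕ l ≢ 0 → ¬ IsZero x → ¬ IsZero (scale l x)
    scale-nonzero {x = x} l≢0 x≢0 lx≡0 =
      x≢0 (λ j → decidable-stable (toℕ (x j) ≟ 0) (λ xj≢0 → ·-nonzero p-prime l≢0 xj≢0 (lx≡0 j)))

    sum-leeWt-·ʳ : ∀ a → sum (λ l → leeWtℤp p (l · a)) ≡ (if toℕ a ≡ᵇ 0 then 0 else 1) * totalLeeWt p
    sum-leeWt-·ʳ a with toℕ a ≡ᵇ 0 in a≡ᵇ0
    ... | true  = trans (sum-cong-≗ (λ l → cong (λ t → t ⊓ (p ∸ t)) (·-zeroʳ l a≡0)))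
                        (sum-replicate-zero p)
      where
      a≡0 : toℕ a ≡ 0
      a≡0 = ≡ᵇ⇒≡ (toℕ a) 0 (subst T (sym a≡ᵇ0) _)
    ... | false = trans (sym (sum-permute (leeWtℤp p) (·ʳ-permutation p-prime a a≢0)))
                        (sym (+-identityʳ (totalLeeWt p)))
      where
      a≢0 : toℕ a ≢ 0
      a≢0 a≡0 = subst T a≡ᵇ0 (≡⇒≡ᵇ (toℕ a) 0 a≡0)

    sum-leeWt-scale : ∀ {n} (x : Vec𝔽 p n) → sum (λ l → leeWt (scale l x)) ≡ hammingWt x * totalLeeWt p
    sum-leeWt-scale {n} x = begin
      sum (λ l → leeWt (scale l x))                     ≡⟨ sum-cong-≗ (λ l → ∑≡sum n (λ j → leeWtℤp p (l · x j))) ⟩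
      sum (λ l → sum (λ j → leeWtℤp p (l · x j)))       ≡⟨ ∑-comm (λ l j → leeWtℤp p (l · x j)) ⟩
      sum (λ j → sum (λ l → leeWtℤp p (l · x j)))       ≡⟨ sum-cong-≗ (λ j → sum-leeWt-·ʳ (x j)) ⟩
      sum (λ j → weight j * totalLeeWt p)               ≡⟨ *-distribʳ-sum (totalLeeWt p) weight ⟨
      sum weight * totalLeeWt p                         ≡⟨ cong (_* totalLeeWt p) (∑≡sum n weight) ⟨
      hammingWt x * totalLeeWt p ∎
      where
      weight : Fin n → ℕ
      weight j = if toℕ (x j) ≡ᵇ 0 then 0 else 1

totalLeeWt-odd : ∀ q → totalLeeWt (suc (q + q)) ≡ q * suc q
totalLeeWt-odd q = begin
  sum {q + q} (λ i → lee (suc (toℕ i)))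
    ≡⟨ sum-toℕ-+ q q (λ i → lee (suc i)) ⟩
  sum {q} (λ i → lee (suc (toℕ i))) + sum {q} (λ i → lee (suc (q + toℕ i)))
    ≡⟨ cong₂ _+_ (sum-cong-≗ {q} (λ i → lee-lower (toℕ<n i))) (sum-cong-≗ {q} (λ i → lee-upper (toℕ i))) ⟩
  sum {q} (λ i → suc (toℕ i)) + sum {q} (λ i → q ∸ toℕ i)
    ≡⟨ ∑-distrib-+ {q} (λ i → suc (toℕ i)) (λ i → q ∸ toℕ i) ⟨
  sum {q} (λ i → suc (toℕ i) + (q ∸ toℕ i))
    ≡⟨ sum-cong-≗ {q} (λ i → cong suc (m+[n∸m]≡n (<⇒≤ (toℕ<n i)))) ⟩
  sum {q} (λ _ → suc q)
    ≡⟨ sum-const q (suc q) ⟩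
  q * suc q ∎
  where
  open ≡-Reasoning
  lee : ℕ → ℕ
  lee i = i ⊓ (suc (q + q) ∸ i)
  lee-lower : ∀ {i} → i < q → lee (suc i) ≡ suc i
  lee-lower {i} i<q = m≤n⇒m⊓n≡m
    (≤-trans i<q (≤-trans (m≤m+n q (q ∸ i)) (≤-reflexive (sym (+-∸-assoc q (<⇒≤ i<q))))))
  lee-upper : ∀ i → lee (suc (q + i)) ≡ q ∸ i
  lee-upper i = begin
    suc (q + i) ⊓ (q + q ∸ (q + i))  ≡⟨ cong (suc (q + i) ⊓_) ([m+n]∸[m+o]≡n∸o q q i) ⟩
    suc (q + i) ⊓ (q ∸ i)            ≡⟨ m≥n⇒m⊓n≡n (≤-trans (m∸n≤m q i) (≤-trans (m≤m+n q i) (n≤1+n _))) ⟩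
    q ∸ i ∎

minLeeDist-bound : ∀ {p n k d dL} .{{_ : NonZero p}} → Prime p → (C : LinearCode p n k) →
                  IsMinDist C d → IsMinLeeDist C dL → (p ∸ 1) * dL ≤ totalLeeWt p * d
minLeeDist-bound {zero} p-prime _ _ _ = contradiction p-prime ¬prime[0]
minLeeDist-bound {suc p} {d = d} {dL} p-prime C ((x , x∈C , x≢0 , wt≡d) , _) (_ , dL-min) = begin
  p * dL                                     ≡⟨ sum-const p dL ⟨
  sum {p} (λ _ → dL)                         ≤⟨ sum-mono-≤ (λ l → dL-min _ (∈C-scale C (fsuc l) x∈C)
                                                                  (scale-nonzero p-prime {l = fsuc l} (λ ()) x≢0)) ⟩
  sum {p} (λ l → leeWt (scale (fsuc l) x))   ≤⟨ m≤n+m _ (leeWt (scale fzero x)) ⟩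
  sum (λ l → leeWt (scale l x))              ≡⟨ sum-leeWt-scale p-prime x ⟩
  hammingWt x * totalLeeWt (suc p)           ≡⟨ cong (_* totalLeeWt (suc p)) wt≡d ⟩
  d * totalLeeWt (suc p)                     ≡⟨ *-comm d _ ⟩
  totalLeeWt (suc p) * d ∎
  where open ≤-Reasoning

floorMu-≢2 : ∀ {p} m → p ≢ 2 → floorMu p m ≡ ((p + 1) * m) / 4
floorMu-≢2 {p} m p≢2 = cong (λ b → if b then m else ((p + 1) * m) / 4) (dec-false (p ≟ 2) p≢2)

prime≢2⇒odd : ∀ {p} → Prime p → p ≢ 2 → ∃[ q ] p ≡ suc (q + q)
prime≢2⇒odd {p} p-prime p≢2 with p % 2 in p%2≡r | m%n<n p 2
... | 0 | _ = contradiction (prime⇒irreducible p-prime (m%n≡0⇒n∣m p 2 p%2≡r)) [ (λ ()) , p≢2 ∘ sym ]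
... | 1 | _ = p / 2 , (begin
  p                    ≡⟨ m≡m%n+[m/n]*n p 2 ⟩
  p % 2 + p / 2 * 2    ≡⟨ cong (_+ p / 2 * 2) p%2≡r ⟩
  1 + p / 2 * 2        ≡⟨ cong suc (*-comm (p / 2) 2) ⟩
  1 + 2 * (p / 2)      ≡⟨ cong (λ t → suc (p / 2 + t)) (+-identityʳ (p / 2)) ⟩
  suc (p / 2 + p / 2)  ∎)
  where open ≡-Reasoning
... | suc (suc _) | s≤s (s≤s ())

≤floorMu-odd : ∀ q .{{_ : NonZero q}} {w m} →
               (q + q) * w ≤ totalLeeWt (suc (q + q)) * m → w ≤ ((suc (q + q) + 1) * m) / 4
≤floorMu-odd q {w} {m} h = m*d≤n⇒m≤n/d (begin
  w * 4                  ≡⟨ solve (w ∷ []) ⟩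
  2 * (2 * w)            ≤⟨ *-monoʳ-≤ 2 (*-cancelˡ-≤ q q*2w≤q*[1+q]m) ⟩
  2 * (suc q * m)        ≡⟨ solve (q ∷ m ∷ []) ⟩
  (suc (q + q) + 1) * m ∎)
  where
  open ≤-Reasoning
  q*2w≤q*[1+q]m : q * (2 * w) ≤ q * (suc q * m)
  q*2w≤q*[1+q]m = begin
    q * (2 * w)                    ≡⟨ solve (q ∷ w ∷ []) ⟩
    (q + q) * w                    ≤⟨ h ⟩
    totalLeeWt (suc (q + q)) * m   ≡⟨ cong (_* m) (totalLeeWt-odd q) ⟩
    q * suc q * m                  ≡⟨ solve (q ∷ m ∷ []) ⟩
    q * (suc q * m)                ∎

-- μ_p = totalLeeWt p / (p - 1), which for p = 2q + 1 is q (q + 1) / 2q = (p + 1) / 4.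
≤floorMu : ∀ {p w m} → Prime p → (p ∸ 1) * w ≤ totalLeeWt p * m → w ≤ floorMu p m
≤floorMu {p} {w} {m} p-prime h with p ≟ 2
... | yes refl = subst₂ _≤_ (+-identityʳ w) (+-identityʳ m) h
... | no p≢2 with prime≢2⇒odd p-prime p≢2
...   | zero , refl = contradiction p-prime ¬prime[1]
...   | q@(suc _) , refl = subst (w ≤_) (sym (floorMu-≢2 m p≢2)) (≤floorMu-odd q h)
lemma13 : (p : ℕ) → .{{_ : NonZero p}} → Prime p →
    (n k d dL s : ℕ) → (C : LinearCode p n k) →
    IsMinDist C d → IsMinLeeDist C dL → 1 ≤ s →
    floorMu p (n ∸ k ∸ s) < dL →
    n ∸ k ∸ s + 1 ≤ d
lemma13 p p-prime n k d dL s C d-min dL-min _ floor<dL with d ≤? n ∸ k ∸ s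
... | no  d≰m = subst (_≤ d) (+-comm 1 (n ∸ k ∸ s)) (≰⇒> d≰m)
... | yes d≤m = contradiction (≤floorMu p-prime mean≤) (<⇒≱ floor<dL)
  where
  mean≤ : (p ∸ 1) * dL ≤ totalLeeWt p * (n ∸ k ∸ s)
  mean≤ = ≤-trans (minLeeDist-bound p-prime C d-min dL-min) (*-monoʳ-≤ (totalLeeWt p) d≤m)
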